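{- Let $n\geq 3$, $G=\langle x,y:~x^n=y^2=e,~yxy=x^{ -1}\rangle$, $A=\langle x\rangle$, let $D$ be a difference set in $A$ with parameters $(n,k,\lambda)$, and let $\Gamma=\mathrm{Cay}(G,A^\#\cup yD)$. Then $\Gamma$ is a strictly Deza graph if and only if $D$ has parameters $\left(n,\frac{2n-1-\sqrt{8n-7}}{2},n+1-\sqrt{8n-7}\right)$.
   Context: $G^\#=G\setminus\{e\}$; $\mathrm{Cay}(G,S)$ has vertex set $G$ and edges $\{g,sg\}$, $s\in S$. A subset $D$ of a group $H$ is a difference set with parameters $(v,k,\lambda)$ if $|H|=v$, $|D|=k$, $\lambda$ is a positive integer, and every element of $H\setminus\{e\}$ is $d_1^{ -1}d_2$ ($d_1,d_2\in D$) in exactly $\lambda$ ways. A $k$-regular graph is a Deza graph if there are nonnegative integers $a,b$ such that every pair of distinct vertices has either $a$ or $b$ common neighbours. A strictly Deza graph is a Deza graph which is not strongly regular and has diameter $2$. -}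

module Defs where

open import Data.Nat using (ℕ; zero; suc; _+_; _∸_; _<_; NonZero)
open import Data.Nat.DivMod using (_mod_)
open import Data.Bool using (Bool; true; false; _∧_; _xor_; not; if_then_else_)
open import Data.Fin using (Fin; toℕ)
import Data.Fin as Fin
open import Data.Fin.Subset using (Subset)
open import Data.Vec using (lookup)
open import Data.Product using (_×_; _,_; ∃; ∃-syntax)
open import Data.Sum using (_⊎_)
open import Relation.Binary.PropositionalEquality using (_≡_; _≢_)
open import Relation.Nullary.Decidable using (⌊_⌋)
open import Relation.Nullary using (¬_)

sumFin : ∀ {m} → (Fin m → ℕ) → ℕ
sumFin {zero}  f = 0
sumFin {suc m} f = f Fin.zero + sumFin (λ i → f (Fin.suc i))

countFin : ∀ {m} → (Fin m → Bool) → ℕ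
countFin f = sumFin (λ i → if f i then 1 else 0)

module GraphNotions {V : Set} (countV : (V → Bool) → ℕ) (adj : V → V → Bool) where

  degree : V → ℕ
  degree g = countV (adj g)

  common : V → V → ℕ
  common g h = countV (λ z → adj g z ∧ adj h z)

  IsRegular : ℕ → Set
  IsRegular k = ∀ g → degree g ≡ k

  IsDeza : Set
  IsDeza = ∃[ k ] IsRegular k × ∃[ a ] ∃[ b ]
             (∀ g h → g ≢ h → (common g h ≡ a) ⊎ (common g h ≡ b))

  IsStronglyRegular : Set
  IsStronglyRegular = ∃[ k ] IsRegular k × ∃[ lam ] ∃[ mu ]
    (∀ g h → g ≢ h → (adj g h ≡ true → common g h ≡ lam)
                    × (adj g h ≡ false → common g h ≡ mu))

  -- diameter exactly 2: any two distinct vertices are at distance ≤ 2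
  -- (adjacent or with a common neighbour), and some two distinct vertices
  -- are not adjacent (distance exactly 2).
  HasDiameter2 : Set
  HasDiameter2 =
    (∀ g h → g ≢ h → (adj g h ≡ true) ⊎ (common g h ≢ 0))
    × (∃[ g ] ∃[ h ] (g ≢ h) × (adj g h ≡ false))

  IsStrictlyDeza : Set
  IsStrictlyDeza = IsDeza × (¬ IsStronglyRegular) × HasDiameter2

module Dihedral (n : ℕ) .{{_ : NonZero n}} where

  -- the cyclic group Z_n ≅ A = ⟨x⟩ (x^i ↦ i)
  _⊕_ : Fin n → Fin n → Fin n
  i ⊕ j = (toℕ i + toℕ j) mod n

  ⊝_ : Fin n → Fin n
  ⊝ i = (n ∸ toℕ i) mod n

  0ₙ : Fin n
  0ₙ = 0 mod n

  IsDifferenceSet : Subset n → ℕ → ℕ → ℕ → Set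
  IsDifferenceSet D v k lam =
    (n ≡ v) × (countFin (lookup D) ≡ k) × (0 < lam) ×
    (∀ (t : Fin n) → t ≢ 0ₙ →
       sumFin (λ d₁ → countFin (λ d₂ →
         lookup D d₁ ∧ lookup D d₂ ∧ ⌊ ((⊝ d₁) ⊕ d₂) Fin.≟ t ⌋)) ≡ lam)

  -- G = ⟨x,y : x^n = y^2 = e, yxy = x⁻¹⟩; (false , i) stands for x^i and
  -- (true , i) for y x^i.  Using x^i y = y x^{-i}:
  -- (y^a x^i)(y^b x^j) = y^(a+b) x^((-1)^b i + j).
  G : Set
  G = Bool × Fin n

  e : G
  e = (false , 0ₙ)

  _·_ : G → G → G
  (a , i) · (b , j) = (a xor b , ((if b then ⊝ i else i) ⊕ j))

  _⁻¹ : G → G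
  (false , i) ⁻¹ = (false , ⊝ i)
  (true  , i) ⁻¹ = (true , i)

  countG : (G → Bool) → ℕ
  countG f = countFin (λ i → f (false , i)) + countFin (λ i → f (true , i))

  inS : Subset n → G → Bool
  inS D (false , i) = not ⌊ i Fin.≟ 0ₙ ⌋
  inS D (true  , i) = lookup D i

  -- Cay(G,S): g and h are adjacent iff h = s g for some s ∈ S, i.e. h g⁻¹ ∈ S
  cayAdj : Subset n → G → G → Bool
  cayAdj D g h = inS D (h · (g ⁻¹))

  module CayGraph (D : Subset n) = GraphNotions countG (cayAdj D)

-- Right multiplication permutes the vertices, so in Cay(G, S) with S = A^# ∪ yD the vertices
-- g and h are adjacent iff gh⁻¹ ∈ S and have |{s ∈ S : s·gh⁻¹ ∈ S}| common neighbours.  For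
-- gh⁻¹ = x^δ ∈ A^# this is (n − 2) + λ: the part in A avoids 0 and −δ, the part in yA counts
-- the representations of δ as a difference in D.  For gh⁻¹ = y x^ε it is 2(k − [x^ε ∈ D]),
-- the reflection i ↦ ε − i matching the two halves.  So adjacent pairs have n − 2 + λ or
-- 2k − 2 common neighbours and non-adjacent pairs 2k, and Γ is strictly Deza iff
-- n − 2 + λ = 2k and D ≠ A.  With the difference-set identity k(k − 1) = λ(n − 1) this says
-- that q = n − k satisfies q(q − 1) = 2(n − 1), i.e. (2q − 1)² = 8n − 7.

module Submission where

open import Defs
open import Algebra.Bundles using (Group; AbelianGroup)
import Algebra.Properties.AbelianGroup as AbelianGroupProperties
import Algebra.Properties.Group as GroupProperties
open import Algebra.Consequences.Propositional using (comm∧idˡ⇒id; comm∧invˡ⇒inv)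
open import Algebra.Structures using (IsAbelianGroup; IsGroup)
open import Level using (0ℓ)
open import Data.Bool using (Bool; true; false; _∧_; _xor_; not; if_then_else_)
open import Data.Bool.Properties
  using (∧-comm; ∧-assoc; ∧-conicalˡ; ∧-zeroʳ; ∧-identityʳ; ∧-idem; not-involutive; xor-assoc; xor-identityʳ; xor-same)
open import Data.Empty using (⊥-elim)
open import Data.Fin using (Fin; toℕ)
import Data.Fin as Fin
open import Data.Fin.Permutation using (permutation)
open import Data.Fin.Properties using (toℕ-fromℕ<; toℕ-injective; toℕ<n)
  renaming (suc-injective to Fin-suc-injective)
open import Data.Fin.Subset using (Subset)
open import Data.Nat using (ℕ; zero; suc; _+_; _*_; _∸_; _≤_; _<_; z≤n; s≤s; NonZero; >-nonZero⁻¹)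
open import Data.Nat.DivMod using (_%_; _mod_; m%n<n; %-distribˡ-+; m%n%n≡m%n; n%n≡0; m<n⇒m%n≡m)
open import Data.Nat.Properties
open import Data.Nat.Tactic.RingSolver using (solve-∀)
open import Data.Product using (_×_; _,_; proj₁; proj₂; ∃-syntax)
open import Data.Sum using (_⊎_; inj₁; inj₂)
open import Data.Vec using (lookup)
open import Function.Bundles using (_⇔_; mk⇔)
open import Relation.Binary.PropositionalEquality
  using (_≡_; _≢_; refl; sym; trans; cong; cong₂; subst; subst₂; isEquivalence; module ≡-Reasoning)
open import Relation.Nullary using (¬_; yes; no)
open import Relation.Nullary.Decidable using (⌊_⌋)

import Algebra.Properties.Semiring.Sum +-*-semiring as Σ

[_] : Bool → ℕ
[ b ] = if b then 1 else 0

_==_ : ∀ {m} → Fin m → Fin m → Bool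
x == y = ⌊ x Fin.≟ y ⌋

==-refl : ∀ {m} (x : Fin m) → (x == x) ≡ true
==-refl x with x Fin.≟ x
... | yes _ = refl
... | no x≢x = ⊥-elim (x≢x refl)

==-≢ : ∀ {m} {x y : Fin m} → x ≢ y → (x == y) ≡ false
==-≢ {x = x} {y} x≢y with x Fin.≟ y
... | yes x≡y = ⊥-elim (x≢y x≡y)
... | no _ = refl

==-cong : ∀ {m l} {x y : Fin m} {u v : Fin l} → (x ≡ y → u ≡ v) → (u ≡ v → x ≡ y) →
          (x == y) ≡ (u == v)
==-cong {x = x} {y} {u} {v} to from with x Fin.≟ y | u Fin.≟ v
... | yes _    | yes _   = refl
... | no _     | no _    = refl
... | yes x≡y  | no u≢v  = ⊥-elim (u≢v (to x≡y))
... | no x≢y   | yes u≡v = ⊥-elim (x≢y (from u≡v))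

sumFin≗sum : ∀ {m} (f : Fin m → ℕ) → sumFin f ≡ Σ.sum f
sumFin≗sum {zero}  f = refl
sumFin≗sum {suc m} f = cong (f Fin.zero +_) (sumFin≗sum (λ i → f (Fin.suc i)))

sumFin-cong : ∀ {m} {f g : Fin m → ℕ} → (∀ x → f x ≡ g x) → sumFin f ≡ sumFin g
sumFin-cong {f = f} {g} f≗g = begin
  sumFin f  ≡⟨ sumFin≗sum f ⟩
  Σ.sum f   ≡⟨ Σ.sum-cong-≗ f≗g ⟩
  Σ.sum g   ≡⟨ sumFin≗sum g ⟨
  sumFin g  ∎
  where open ≡-Reasoning

sumFin-+ : ∀ {m} (f g : Fin m → ℕ) → sumFin (λ x → f x + g x) ≡ sumFin f + sumFin g
sumFin-+ f g = begin
  sumFin (λ x → f x + g x)  ≡⟨ sumFin≗sum (λ x → f x + g x) ⟩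
  Σ.sum (λ x → f x + g x)   ≡⟨ Σ.∑-distrib-+ f g ⟩
  Σ.sum f + Σ.sum g         ≡⟨ cong₂ _+_ (sumFin≗sum f) (sumFin≗sum g) ⟨
  sumFin f + sumFin g       ∎
  where open ≡-Reasoning

sumFin-swap : ∀ {m l} (f : Fin m → Fin l → ℕ) →
              sumFin (λ i → sumFin (f i)) ≡ sumFin (λ j → sumFin (λ i → f i j))
sumFin-swap f = begin
  sumFin (λ i → sumFin (f i))             ≡⟨ sumFin-cong (λ i → sumFin≗sum (f i)) ⟩
  sumFin (λ i → Σ.sum (f i))              ≡⟨ sumFin≗sum (λ i → Σ.sum (f i)) ⟩
  Σ.sum (λ i → Σ.sum (f i))               ≡⟨ Σ.∑-comm f ⟩
  Σ.sum (λ j → Σ.sum (λ i → f i j))       ≡⟨ sumFin≗sum (λ j → Σ.sum (λ i → f i j)) ⟨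
  sumFin (λ j → Σ.sum (λ i → f i j))      ≡⟨ sumFin-cong (λ j → sumFin≗sum (λ i → f i j)) ⟨
  sumFin (λ j → sumFin (λ i → f i j))     ∎
  where open ≡-Reasoning

sumFin-reindex : ∀ {m} (f : Fin m → ℕ) (π π⁻ : Fin m → Fin m) →
                 (∀ y → π (π⁻ y) ≡ y) → (∀ x → π⁻ (π x) ≡ x) →
                 sumFin (λ x → f (π x)) ≡ sumFin f
sumFin-reindex f π π⁻ ππ⁻ π⁻π = begin
  sumFin (λ x → f (π x))  ≡⟨ sumFin≗sum (λ x → f (π x)) ⟩
  Σ.sum (λ x → f (π x))   ≡⟨ Σ.sum-permute f (permutation π π⁻ ππ⁻ π⁻π) ⟨
  Σ.sum f                 ≡⟨ sumFin≗sum f ⟨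
  sumFin f                ∎
  where open ≡-Reasoning

countFin-cong : ∀ {m} {f g : Fin m → Bool} → (∀ x → f x ≡ g x) → countFin f ≡ countFin g
countFin-cong f≗g = sumFin-cong (λ x → cong [_] (f≗g x))

countFin-reindex : ∀ {m} (f : Fin m → Bool) (π π⁻ : Fin m → Fin m) →
                   (∀ y → π (π⁻ y) ≡ y) → (∀ x → π⁻ (π x) ≡ x) →
                   countFin (λ x → f (π x)) ≡ countFin f
countFin-reindex f = sumFin-reindex (λ x → [ f x ])

countFin-true : ∀ m → countFin {m} (λ _ → true) ≡ m
countFin-true zero    = refl
countFin-true (suc m) = cong suc (countFin-true m)

countFin-false : ∀ m → countFin {m} (λ _ → false) ≡ 0
countFin-false zero    = refl
countFin-false (suc m) = countFin-false m

countFin-split : ∀ {m} (f g : Fin m → Bool) →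
                 countFin f ≡ countFin (λ x → f x ∧ g x) + countFin (λ x → f x ∧ not (g x))
countFin-split f g =
  trans (sumFin-cong (λ x → split (f x) (g x))) (sumFin-+ (λ x → [ f x ∧ g x ]) (λ x → [ f x ∧ not (g x) ]))
  where
  split : ∀ a b → [ a ] ≡ [ a ∧ b ] + [ a ∧ not b ]
  split false _     = refl
  split true  false = refl
  split true  true  = refl

countFin-complement : ∀ {m} (f : Fin m → Bool) → countFin f + countFin (λ x → not (f x)) ≡ m
countFin-complement {m} f = trans (sym (countFin-split (λ _ → true) f)) (countFin-true m)

countFin-∧-== : ∀ {m} (f : Fin m → Bool) (c : Fin m) → countFin (λ x → f x ∧ (x == c)) ≡ [ f c ]
countFin-∧-== {suc m} f Fin.zero = begin
  [ f Fin.zero ∧ (Fin.zero == Fin.zero {m}) ] + countFin (λ i → f (Fin.suc i) ∧ (Fin.suc i == Fin.zero))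
    ≡⟨ cong₂ _+_ (cong (λ b → [ f Fin.zero ∧ b ]) (==-refl {suc m} Fin.zero))
                 (countFin-cong (λ i → trans (cong (f (Fin.suc i) ∧_) (==-≢ {x = Fin.suc i} {Fin.zero} λ ()))
                                             (∧-zeroʳ _))) ⟩
  [ f Fin.zero ∧ true ] + countFin {m} (λ _ → false)
    ≡⟨ cong₂ _+_ (cong [_] (∧-identityʳ _)) (countFin-false m) ⟩
  [ f Fin.zero ] + 0
    ≡⟨ +-identityʳ _ ⟩
  [ f Fin.zero ] ∎
  where open ≡-Reasoning
countFin-∧-== {suc m} f (Fin.suc c) = begin
  [ f Fin.zero ∧ (Fin.zero == Fin.suc c) ] + countFin (λ i → f (Fin.suc i) ∧ (Fin.suc i == Fin.suc c))
    ≡⟨ cong₂ _+_ (cong [_] (trans (cong (f Fin.zero ∧_) (==-≢ {x = Fin.zero} {Fin.suc c} λ ())) (∧-zeroʳ _)))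
                 (countFin-cong (λ i → cong (f (Fin.suc i) ∧_) (==-cong Fin-suc-injective (cong Fin.suc)))) ⟩
  0 + countFin (λ i → f (Fin.suc i) ∧ (i == c))
    ≡⟨ countFin-∧-== (λ i → f (Fin.suc i)) c ⟩
  [ f (Fin.suc c) ] ∎
  where open ≡-Reasoning

countFin-== : ∀ {m} (c : Fin m) → countFin (λ x → x == c) ≡ 1
countFin-== c = countFin-∧-== (λ _ → true) c

countFin-∧-≢ : ∀ {m} (f : Fin m → Bool) (c : Fin m) →
              countFin (λ x → f x ∧ not (x == c)) + [ f c ] ≡ countFin f
countFin-∧-≢ f c = begin
  countFin (λ x → f x ∧ not (x == c)) + [ f c ]
    ≡⟨ +-comm _ [ f c ] ⟩
  [ f c ] + countFin (λ x → f x ∧ not (x == c))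
    ≡⟨ cong (_+ countFin (λ x → f x ∧ not (x == c))) (countFin-∧-== f c) ⟨
  countFin (λ x → f x ∧ (x == c)) + countFin (λ x → f x ∧ not (x == c))
    ≡⟨ countFin-split f (_== c) ⟨
  countFin f ∎
  where open ≡-Reasoning

countFin-≢ : ∀ {m} (c : Fin m) → countFin (λ x → not (x == c)) + 1 ≡ m
countFin-≢ {m} c = begin
  r + 1                  ≡⟨ +-comm r 1 ⟩
  1 + r                  ≡⟨ cong (_+ r) (countFin-== c) ⟨
  countFin (_== c) + r   ≡⟨ countFin-complement (_== c) ⟩
  m                      ∎
  where
  open ≡-Reasoning
  r : ℕ
  r = countFin (λ x → not (x == c))

countFin-≢-≢ : ∀ {m} {a b : Fin m} → a ≢ b →
               countFin (λ x → not (x == a) ∧ not (x == b)) + 2 ≡ m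
countFin-≢-≢ {m} {a} {b} a≢b = begin
  r + 2                                ≡⟨ +-assoc r 1 1 ⟨
  r + 1 + 1                            ≡⟨ cong (λ c → r + [ not c ] + 1) (==-≢ (λ b≡a → a≢b (sym b≡a))) ⟨
  r + [ not (b == a) ] + 1             ≡⟨ cong (_+ 1) (countFin-∧-≢ (λ x → not (x == a)) b) ⟩
  countFin (λ x → not (x == a)) + 1    ≡⟨ countFin-≢ a ⟩
  m                                    ∎
  where
  open ≡-Reasoning
  r : ℕ
  r = countFin (λ x → not (x == a) ∧ not (x == b))

sumFin-*ˡ : ∀ {m} a (f : Fin m → ℕ) → sumFin (λ x → a * f x) ≡ a * sumFin f
sumFin-*ˡ a f = begin
  sumFin (λ x → a * f x)   ≡⟨ sumFin≗sum (λ x → a * f x) ⟩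
  Σ.sum (λ x → a * f x)    ≡⟨ Σ.*-distribˡ-sum a f ⟨
  a * Σ.sum f              ≡⟨ cong (a *_) (sumFin≗sum f) ⟨
  a * sumFin f             ∎
  where open ≡-Reasoning

sumFin-if : ∀ {m} (f : Fin m → Bool) a b →
            sumFin (λ x → if f x then a else b) ≡ a * countFin f + b * countFin (λ x → not (f x))
sumFin-if f a b = begin
  sumFin (λ x → if f x then a else b)
    ≡⟨ sumFin-cong (λ x → pointwise (f x)) ⟩
  sumFin (λ x → a * [ f x ] + b * [ not (f x) ])
    ≡⟨ sumFin-+ (λ x → a * [ f x ]) (λ x → b * [ not (f x) ]) ⟩
  sumFin (λ x → a * [ f x ]) + sumFin (λ x → b * [ not (f x) ])
    ≡⟨ cong₂ _+_ (sumFin-*ˡ a (λ x → [ f x ])) (sumFin-*ˡ b (λ x → [ not (f x) ])) ⟩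
  a * countFin f + b * countFin (λ x → not (f x)) ∎
  where
  open ≡-Reasoning
  pointwise : ∀ c → (if c then a else b) ≡ a * [ c ] + b * [ not c ]
  pointwise true  = sym (trans (cong₂ _+_ (*-identityʳ a) (*-zeroʳ b)) (+-identityʳ a))
  pointwise false = sym (trans (cong₂ _+_ (*-zeroʳ a) (*-identityʳ b)) refl)

countFin-≤ : ∀ {m} (f : Fin m → Bool) → countFin f ≤ m
countFin-≤ f = subst (countFin f ≤_) (countFin-complement f) (m≤m+n _ _)

0<countFin⇒∃ : ∀ {m} (f : Fin m → Bool) → 0 < countFin f → ∃[ x ] f x ≡ true
0<countFin⇒∃ {suc m} f 0<c with f Fin.zero in f0≡true
... | true  = Fin.zero , f0≡true
... | false = let x , fx≡true = 0<countFin⇒∃ (λ i → f (Fin.suc i)) 0<c in Fin.suc x , fx≡true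

countFin<⇒∃ : ∀ {m} (f : Fin m → Bool) → countFin f < m → ∃[ x ] f x ≡ false
countFin<⇒∃ {m} f c<m =
  let x , notfx≡true = 0<countFin⇒∃ (λ x → not (f x)) 0<count-not
  in x , trans (sym (not-involutive (f x))) (cong not notfx≡true)
  where
  0<count-not : 0 < countFin (λ x → not (f x))
  0<count-not = +-cancelˡ-< (countFin f) 0 (countFin (λ x → not (f x)))
    (subst₂ _<_ (sym (+-identityʳ (countFin f))) (sym (countFin-complement f)) c<m)

module Cyclic (n : ℕ) .{{_ : NonZero n}} where
  open Dihedral n
  open ≡-Reasoning

  toℕ-mod : ∀ a → toℕ (a mod n) ≡ a % n
  toℕ-mod a = toℕ-fromℕ< (m%n<n a n)

  toℕ-0ₙ : toℕ 0ₙ ≡ 0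
  toℕ-0ₙ = trans (toℕ-mod 0) (m<n⇒m%n≡m (>-nonZero⁻¹ n))

  mod-toℕ : ∀ x → toℕ x mod n ≡ x
  mod-toℕ x = toℕ-injective (trans (toℕ-mod (toℕ x)) (m<n⇒m%n≡m (toℕ<n x)))

  mod-cong : ∀ {a b} → a % n ≡ b % n → a mod n ≡ b mod n
  mod-cong {a} {b} eq = toℕ-injective (trans (toℕ-mod a) (trans eq (sym (toℕ-mod b))))

  [m%n+o]%n≡[m+o]%n : ∀ a b → (a % n + b) % n ≡ (a + b) % n
  [m%n+o]%n≡[m+o]%n a b = begin
    (a % n + b) % n          ≡⟨ %-distribˡ-+ (a % n) b n ⟩
    (a % n % n + b % n) % n  ≡⟨ cong (λ r → (r + b % n) % n) (m%n%n≡m%n a n) ⟩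
    (a % n + b % n) % n      ≡⟨ %-distribˡ-+ a b n ⟨
    (a + b) % n              ∎

  mod-⊕ : ∀ a y → (a mod n) ⊕ y ≡ (a + toℕ y) mod n
  mod-⊕ a y = mod-cong (trans (cong (λ r → (r + toℕ y) % n) (toℕ-mod a)) ([m%n+o]%n≡[m+o]%n a (toℕ y)))

  ⊕-comm : ∀ x y → x ⊕ y ≡ y ⊕ x
  ⊕-comm x y = cong (_mod n) (+-comm (toℕ x) (toℕ y))

  ⊕-assoc : ∀ x y z → (x ⊕ y) ⊕ z ≡ x ⊕ (y ⊕ z)
  ⊕-assoc x y z = begin
    (x ⊕ y) ⊕ z                     ≡⟨ mod-⊕ (toℕ x + toℕ y) z ⟩
    (toℕ x + toℕ y + toℕ z) mod n   ≡⟨ cong (_mod n) (+-assoc (toℕ x) (toℕ y) (toℕ z)) ⟩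
    (toℕ x + (toℕ y + toℕ z)) mod n ≡⟨ cong (_mod n) (+-comm (toℕ x) (toℕ y + toℕ z)) ⟩
    (toℕ y + toℕ z + toℕ x) mod n   ≡⟨ mod-⊕ (toℕ y + toℕ z) x ⟨
    (y ⊕ z) ⊕ x                     ≡⟨ ⊕-comm (y ⊕ z) x ⟩
    x ⊕ (y ⊕ z)                     ∎

  ⊕-identityˡ : ∀ x → 0ₙ ⊕ x ≡ x
  ⊕-identityˡ x = trans (mod-⊕ 0 x) (mod-toℕ x)

  ⊝-inverseˡ : ∀ x → (⊝ x) ⊕ x ≡ 0ₙ
  ⊝-inverseˡ x = begin
    (⊝ x) ⊕ x                   ≡⟨ mod-⊕ (n ∸ toℕ x) x ⟩
    (n ∸ toℕ x + toℕ x) mod n   ≡⟨ cong (_mod n) (m∸n+n≡m (<⇒≤ (toℕ<n x))) ⟩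
    n mod n                     ≡⟨ toℕ-injective (trans (toℕ-mod n) (trans (n%n≡0 n) (sym toℕ-0ₙ))) ⟩
    0ₙ                          ∎

  ⊕-⊝-isAbelianGroup : IsAbelianGroup _≡_ _⊕_ 0ₙ ⊝_
  ⊕-⊝-isAbelianGroup = record
    { isGroup = record
      { isMonoid = record
        { isSemigroup = record
          { isMagma = record { isEquivalence = isEquivalence ; ∙-cong = cong₂ _⊕_ }
          ; assoc = ⊕-assoc }
        ; identity = comm∧idˡ⇒id ⊕-comm ⊕-identityˡ }
      ; inverse = comm∧invˡ⇒inv ⊕-comm ⊝-inverseˡ
      ; ⁻¹-cong = cong ⊝_ }
    ; comm = ⊕-comm }

  ℤₙ : AbelianGroup 0ℓ 0ℓ
  ℤₙ = record { isAbelianGroup = ⊕-⊝-isAbelianGroup }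

  module ℤ where
    open AbelianGroup ℤₙ public
    open AbelianGroupProperties ℤₙ public

  ⊝≡0ₙ⇒≡0ₙ : ∀ {i} → ⊝ i ≡ 0ₙ → i ≡ 0ₙ
  ⊝≡0ₙ⇒≡0ₙ ⊝i≡0 = ℤ.⁻¹-injective (trans ⊝i≡0 (sym ℤ.ε⁻¹≈ε))

  ⊝-==0ₙ : ∀ i → ((⊝ i) == 0ₙ) ≡ (i == 0ₙ)
  ⊝-==0ₙ i = ==-cong ⊝≡0ₙ⇒≡0ₙ (λ i≡0 → trans (cong ⊝_ i≡0) ℤ.ε⁻¹≈ε)

  ⊕-==0ₙ : ∀ i δ → ((i ⊕ δ) == 0ₙ) ≡ (i == (⊝ δ))
  ⊕-==0ₙ i δ = ==-cong (ℤ.inverseˡ-unique i δ)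
                       (λ i≡⊝δ → trans (cong (_⊕ δ) i≡⊝δ) (ℤ.inverseˡ δ))

  ⊝⊕-==0ₙ : ∀ i ε → (((⊝ i) ⊕ ε) == 0ₙ) ≡ (i == ε)
  ⊝⊕-==0ₙ i ε = ==-cong
    (λ ⊝i⊕ε≡0 → sym (trans (ℤ.inverseʳ-unique (⊝ i) ε ⊝i⊕ε≡0) (ℤ.⁻¹-involutive i)))
    (λ i≡ε → trans (cong (λ j → (⊝ j) ⊕ ε) i≡ε) (ℤ.inverseˡ ε))

  ⊝⊕-involutive : ∀ i ε → (⊝ ((⊝ i) ⊕ ε)) ⊕ ε ≡ i
  ⊝⊕-involutive i ε = begin
    (⊝ ((⊝ i) ⊕ ε)) ⊕ ε        ≡⟨ cong (_⊕ ε) (ℤ.⁻¹-∙-comm (⊝ i) ε) ⟨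
    ((⊝ (⊝ i)) ⊕ (⊝ ε)) ⊕ ε    ≡⟨ ℤ.//-rightDividesˡ ε (⊝ (⊝ i)) ⟩
    ⊝ (⊝ i)                    ≡⟨ ℤ.⁻¹-involutive i ⟩
    i                          ∎

module DihedralGroup (n : ℕ) .{{_ : NonZero n}} where
  open Dihedral n
  open Cyclic n
  open ≡-Reasoning

  twist : Bool → Fin n → Fin n
  twist b i = if b then ⊝ i else i

  twist-⊕ : ∀ b i j → twist b (i ⊕ j) ≡ twist b i ⊕ twist b j
  twist-⊕ false i j = refl
  twist-⊕ true  i j = sym (ℤ.⁻¹-∙-comm i j)

  twist-twist : ∀ a b i → twist b (twist a i) ≡ twist (a xor b) i
  twist-twist false b     i = refl
  twist-twist true  false i = refl
  twist-twist true  true  i = ℤ.⁻¹-involutive i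

  twist-involutive : ∀ b i → twist b (twist b i) ≡ i
  twist-involutive b i = trans (twist-twist b b i) (cong (λ c → twist c i) (xor-same b))

  twist-0ₙ : ∀ b → twist b 0ₙ ≡ 0ₙ
  twist-0ₙ false = refl
  twist-0ₙ true  = ℤ.ε⁻¹≈ε

  ·-assoc : ∀ g h l → (g · h) · l ≡ g · (h · l)
  ·-assoc (a , i) (b , j) (c , l) = cong₂ _,_ (xor-assoc a b c) (begin
    twist c (twist b i ⊕ j) ⊕ l              ≡⟨ cong (_⊕ l) (twist-⊕ c (twist b i) j) ⟩
    (twist c (twist b i) ⊕ twist c j) ⊕ l    ≡⟨ ⊕-assoc (twist c (twist b i)) (twist c j) l ⟩
    twist c (twist b i) ⊕ (twist c j ⊕ l)    ≡⟨ cong (_⊕ (twist c j ⊕ l)) (twist-twist b c i) ⟩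
    twist (b xor c) i ⊕ (twist c j ⊕ l)      ∎)

  ·-identityˡ : ∀ g → e · g ≡ g
  ·-identityˡ (b , j) = cong (b ,_) (trans (cong (_⊕ j) (twist-0ₙ b)) (ℤ.identityˡ j))

  ·-identityʳ : ∀ g → g · e ≡ g
  ·-identityʳ (a , i) = cong₂ _,_ (xor-identityʳ a) (ℤ.identityʳ i)

  ⁻¹-inverseˡ : ∀ g → (g ⁻¹) · g ≡ e
  ⁻¹-inverseˡ (false , i) = cong (false ,_) (ℤ.inverseˡ i)
  ⁻¹-inverseˡ (true  , i) = cong (false ,_) (ℤ.inverseˡ i)

  ⁻¹-inverseʳ : ∀ g → g · (g ⁻¹) ≡ e
  ⁻¹-inverseʳ (false , i) = cong (false ,_) (ℤ.inverseʳ i)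
  ⁻¹-inverseʳ (true  , i) = cong (false ,_) (ℤ.inverseˡ i)

  ·-⁻¹-isGroup : IsGroup _≡_ _·_ e _⁻¹
  ·-⁻¹-isGroup = record
    { isMonoid = record
      { isSemigroup = record
        { isMagma = record { isEquivalence = isEquivalence ; ∙-cong = cong₂ _·_ }
        ; assoc = ·-assoc }
      ; identity = ·-identityˡ , ·-identityʳ }
    ; inverse = ⁻¹-inverseˡ , ⁻¹-inverseʳ
    ; ⁻¹-cong = cong _⁻¹ }

  D₂ₙ : Group 0ℓ 0ℓ
  D₂ₙ = record { isGroup = ·-⁻¹-isGroup }

  module 𝔾 = GroupProperties D₂ₙ

  countFin-twist-⊕ : ∀ b c (f : Fin n → Bool) → countFin (λ i → f (twist b i ⊕ c)) ≡ countFin f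
  countFin-twist-⊕ b c f =
    countFin-reindex f (λ i → twist b i ⊕ c) (λ j → twist b (j ⊕ (⊝ c))) inverseʳ inverseˡ
    where
    inverseʳ : ∀ j → twist b (twist b (j ⊕ (⊝ c))) ⊕ c ≡ j
    inverseʳ j = trans (cong (_⊕ c) (twist-involutive b (j ⊕ (⊝ c)))) (ℤ.//-rightDividesˡ c j)
    inverseˡ : ∀ i → twist b ((twist b i ⊕ c) ⊕ (⊝ c)) ≡ i
    inverseˡ i = trans (cong (twist b) (ℤ.//-rightDividesʳ c (twist b i))) (twist-involutive b i)

  countG-cong : ∀ {f g : G → Bool} → (∀ x → f x ≡ g x) → countG f ≡ countG g
  countG-cong f≗g = cong₂ _+_ (countFin-cong (λ i → f≗g (false , i))) (countFin-cong (λ i → f≗g (true , i)))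

  countG-·ʳ : ∀ (f : G → Bool) w → countG (λ g → f (g · w)) ≡ countG f
  countG-·ʳ f (b , c) = begin
    countFin (λ i → f (b , twist b i ⊕ c)) + countFin (λ i → f (true xor b , twist b i ⊕ c))
      ≡⟨ cong₂ _+_ (countFin-twist-⊕ b c (λ i → f (b , i)))
                   (countFin-twist-⊕ b c (λ i → f (true xor b , i))) ⟩
    countFin (λ i → f (b , i)) + countFin (λ i → f (true xor b , i))
      ≡⟨ cosets b ⟩
    countG f ∎
    where
    cosets : ∀ b → countFin (λ i → f (b , i)) + countFin (λ i → f (true xor b , i)) ≡ countG f
    cosets false = refl
    cosets true  = +-comm (countFin (λ i → f (true , i))) (countFin (λ i → f (false , i)))

module CayleyGraph (n : ℕ) .{{_ : NonZero n}} (D : Subset n) where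
  open Dihedral n
  open Cyclic n
  open DihedralGroup n
  open Dihedral.CayGraph n D
  open ≡-Reasoning

  S : G → Bool
  S = inS D

  S-⁻¹ : ∀ g → S (g ⁻¹) ≡ S g
  S-⁻¹ (false , i) = cong not (⊝-==0ₙ i)
  S-⁻¹ (true  , i) = refl

  cayAdj≡S : ∀ g h → cayAdj D g h ≡ S (g · (h ⁻¹))
  cayAdj≡S g h = begin
    S (h · (g ⁻¹))         ≡⟨ cong S (𝔾.⁻¹-anti-homo-// g h) ⟨
    S ((g · (h ⁻¹)) ⁻¹)    ≡⟨ S-⁻¹ (g · (h ⁻¹)) ⟩
    S (g · (h ⁻¹))         ∎

  overlapS : G → ℕ
  overlapS w = countG (λ s → S s ∧ S (s · w))

  common≡overlapS : ∀ g h → common g h ≡ overlapS (g · (h ⁻¹))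
  common≡overlapS g h = begin
    countG (λ z → S (z · (g ⁻¹)) ∧ S (z · (h ⁻¹)))
      ≡⟨ countG-·ʳ (λ z → S (z · (g ⁻¹)) ∧ S (z · (h ⁻¹))) g ⟨
    countG (λ s → S ((s · g) · (g ⁻¹)) ∧ S ((s · g) · (h ⁻¹)))
      ≡⟨ countG-cong (λ s → cong₂ _∧_ (cong S (𝔾.//-rightDividesʳ g s)) (cong S (·-assoc s g (h ⁻¹)))) ⟩
    overlapS (g · (h ⁻¹)) ∎

  degree≡countG-S : ∀ g → degree g ≡ countG S
  degree≡countG-S g = countG-·ʳ S (g ⁻¹)

  ·e⁻¹ : ∀ w → w · (e ⁻¹) ≡ w
  ·e⁻¹ w = trans (cong (w ·_) 𝔾.ε⁻¹≈ε) (·-identityʳ w)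

  cayAdj-e≡S : ∀ w → cayAdj D w e ≡ S w
  cayAdj-e≡S w = trans (cayAdj≡S w e) (cong S (·e⁻¹ w))

  common-e≡overlapS : ∀ w → common w e ≡ overlapS w
  common-e≡overlapS w = trans (common≡overlapS w e) (cong overlapS (·e⁻¹ w))

module DifferenceSet (n : ℕ) .{{_ : NonZero n}} (D : Subset n) (k lam : ℕ)
                     (isDS : Dihedral.IsDifferenceSet n D n k lam) where
  open Dihedral n
  open Cyclic n
  open DihedralGroup n
  open ≡-Reasoning

  |D|≡k : countFin (lookup D) ≡ k
  |D|≡k = proj₁ (proj₂ isDS)

  0<lam : 0 < lam
  0<lam = proj₁ (proj₂ (proj₂ isDS))

  Λ : Fin n → ℕ
  Λ t = countFin (λ u → lookup D u ∧ lookup D (u ⊕ t))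

  Λ-≢0ₙ : ∀ t → t ≢ 0ₙ → Λ t ≡ lam
  Λ-≢0ₙ t t≢0 = trans (sym (sumFin-cong row)) (proj₂ (proj₂ (proj₂ isDS)) t t≢0)
    where
    row : ∀ d₁ → countFin (λ d₂ → lookup D d₁ ∧ lookup D d₂ ∧ (((⊝ d₁) ⊕ d₂) == t))
                 ≡ [ lookup D d₁ ∧ lookup D (d₁ ⊕ t) ]
    row d₁ = trans
      (countFin-cong (λ d₂ → trans (sym (∧-assoc (lookup D d₁) (lookup D d₂) _))
        (cong ((lookup D d₁ ∧ lookup D d₂) ∧_)
          (==-cong (λ eq → trans (sym (ℤ.\\-leftDividesˡ d₁ d₂)) (cong (d₁ ⊕_) eq))
                   (λ eq → trans (cong ((⊝ d₁) ⊕_) eq) (ℤ.\\-leftDividesʳ d₁ t))))))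
      (countFin-∧-== (λ d₂ → lookup D d₁ ∧ lookup D d₂) (d₁ ⊕ t))

  Λ-0ₙ : Λ 0ₙ ≡ k
  Λ-0ₙ = trans (countFin-cong (λ u → trans (cong (λ v → lookup D u ∧ lookup D v) (ℤ.identityʳ u))
                                          (∧-idem (lookup D u))))
               |D|≡k

  Λ-if : ∀ t → Λ t ≡ (if t == 0ₙ then k else lam)
  Λ-if t with t Fin.≟ 0ₙ
  ... | yes refl = Λ-0ₙ
  ... | no t≢0   = Λ-≢0ₙ t t≢0

  Σ-Λ≡k*k : sumFin Λ ≡ k * k
  Σ-Λ≡k*k = begin
    sumFin Λ
      ≡⟨ sumFin-swap (λ t u → [ lookup D u ∧ lookup D (u ⊕ t) ]) ⟩
    sumFin (λ u → countFin (λ t → lookup D u ∧ lookup D (u ⊕ t)))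
      ≡⟨ sumFin-cong translates ⟩
    sumFin (λ u → if lookup D u then k else 0)
      ≡⟨ sumFin-if (lookup D) k 0 ⟩
    k * countFin (lookup D) + 0 * c
      ≡⟨ cong (λ d → k * d + 0) |D|≡k ⟩
    k * k + 0
      ≡⟨ +-identityʳ (k * k) ⟩
    k * k ∎
    where
    c : ℕ
    c = countFin (λ u → not (lookup D u))
    translates : ∀ u → countFin (λ t → lookup D u ∧ lookup D (u ⊕ t)) ≡ (if lookup D u then k else 0)
    translates u with lookup D u
    ... | true  = trans (countFin-cong (λ t → cong (lookup D) (ℤ.comm u t)))
                        (trans (countFin-twist-⊕ false u (lookup D)) |D|≡k)
    ... | false = countFin-false n

  difference-set-equation : k * k + lam ≡ k + lam * n
  difference-set-equation = begin
    k * k + lam                                           ≡⟨ cong (_+ lam) Σ-Λ≡k*k ⟨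
    sumFin Λ + lam                                        ≡⟨ cong (_+ lam) (sumFin-cong Λ-if) ⟩
    sumFin (λ t → if t == 0ₙ then k else lam) + lam       ≡⟨ cong (_+ lam) (sumFin-if (_== 0ₙ) k lam) ⟩
    k * countFin (_== 0ₙ) + lam * c + lam                 ≡⟨ cong (λ d → k * d + lam * c + lam) (countFin-== 0ₙ) ⟩
    k * 1 + lam * c + lam                                 ≡⟨ regroup k lam c ⟩
    k + lam * (c + 1)                                     ≡⟨ cong (λ d → k + lam * d) (countFin-≢ 0ₙ) ⟩
    k + lam * n                                           ∎
    where
    c : ℕ
    c = countFin (λ t → not (t == 0ₙ))
    regroup : ∀ k lam c → k * 1 + lam * c + lam ≡ k + lam * (c + 1)
    regroup = solve-∀

module DifferenceSetCayleyGraph (n : ℕ) .{{_ : NonZero n}} (D : Subset n) (k lam : ℕ)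
                                (isDS : Dihedral.IsDifferenceSet n D n k lam) where
  open Dihedral n
  open Cyclic n
  open DihedralGroup n
  open Dihedral.CayGraph n D
  open CayleyGraph n D
  open DifferenceSet n D k lam isDS
  open ≡-Reasoning

  countG-S : countG S + 1 ≡ n + k
  countG-S = begin
    a + d + 1    ≡⟨ +-assoc a d 1 ⟩
    a + (d + 1)  ≡⟨ cong (a +_) (+-comm d 1) ⟩
    a + (1 + d)  ≡⟨ +-assoc a 1 d ⟨
    a + 1 + d    ≡⟨ cong₂ _+_ (countFin-≢ 0ₙ) |D|≡k ⟩
    n + k        ∎
    where
    a d : ℕ
    a = countFin (λ i → not (i == 0ₙ))
    d = countFin (lookup D)

  overlapS-A : ∀ δ → δ ≢ 0ₙ → overlapS (false , δ) + 2 ≡ n + lam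
  overlapS-A δ δ≢0 = begin
    countFin (λ i → S (false , i) ∧ S (false , i ⊕ δ)) + Λ δ + 2
      ≡⟨ cong (λ c → c + Λ δ + 2)
              (countFin-cong (λ i → cong (λ b → S (false , i) ∧ not b) (⊕-==0ₙ i δ))) ⟩
    c + Λ δ + 2   ≡⟨ +-assoc c (Λ δ) 2 ⟩
    c + (Λ δ + 2) ≡⟨ cong (c +_) (+-comm (Λ δ) 2) ⟩
    c + (2 + Λ δ) ≡⟨ +-assoc c 2 (Λ δ) ⟨
    c + 2 + Λ δ   ≡⟨ cong₂ _+_ (countFin-≢-≢ 0ₙ≢⊝δ) (Λ-≢0ₙ δ δ≢0) ⟩
    n + lam       ∎
    where
    c : ℕ
    c = countFin (λ i → not (i == 0ₙ) ∧ not (i == (⊝ δ)))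
    0ₙ≢⊝δ : 0ₙ ≢ (⊝ δ)
    0ₙ≢⊝δ 0≡⊝δ = δ≢0 (⊝≡0ₙ⇒≡0ₙ (sym 0≡⊝δ))

  overlapS-yA : ∀ ε → overlapS (true , ε) + 2 * [ lookup D ε ] ≡ 2 * k
  overlapS-yA ε = begin
    overlapS (true , ε) + 2 * [ lookup D ε ]  ≡⟨ cong (_+ 2 * [ lookup D ε ]) (cong₂ _+_ from-A from-yA) ⟩
    r + r + 2 * [ lookup D ε ]                ≡⟨ regroup r [ lookup D ε ] ⟩
    2 * (r + [ lookup D ε ])                  ≡⟨ cong (2 *_) (trans (countFin-∧-≢ (lookup D) ε) |D|≡k) ⟩
    2 * k                                     ∎
    where
    r : ℕ
    r = countFin (λ i → lookup D i ∧ not (i == ε))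
    regroup : ∀ r b → r + r + 2 * b ≡ 2 * (r + b)
    regroup = solve-∀
    from-yA : countFin (λ i → lookup D i ∧ not (((⊝ i) ⊕ ε) == 0ₙ)) ≡ r
    from-yA = countFin-cong (λ i → cong (λ b → lookup D i ∧ not b) (⊝⊕-==0ₙ i ε))
    -- The reflection i ↦ ⊝ i ⊕ ε is an involution turning this count into the one over yA.
    from-A : countFin (λ i → not (i == 0ₙ) ∧ lookup D ((⊝ i) ⊕ ε)) ≡ r
    from-A = trans (countFin-cong reflected) (countFin-twist-⊕ true ε (λ j → lookup D j ∧ not (j == ε)))
      where
      reflected : ∀ i → (not (i == 0ₙ) ∧ lookup D ((⊝ i) ⊕ ε))
                        ≡ (lookup D ((⊝ i) ⊕ ε) ∧ not (((⊝ i) ⊕ ε) == ε))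
      reflected i = begin
        not (i == 0ₙ) ∧ lookup D ((⊝ i) ⊕ ε)
          ≡⟨ ∧-comm (not (i == 0ₙ)) _ ⟩
        lookup D ((⊝ i) ⊕ ε) ∧ not (i == 0ₙ)
          ≡⟨ cong (λ j → lookup D ((⊝ i) ⊕ ε) ∧ not (j == 0ₙ)) (⊝⊕-involutive i ε) ⟨
        lookup D ((⊝ i) ⊕ ε) ∧ not (((⊝ ((⊝ i) ⊕ ε)) ⊕ ε) == 0ₙ)
          ≡⟨ cong (λ b → lookup D ((⊝ i) ⊕ ε) ∧ not b) (⊝⊕-==0ₙ ((⊝ i) ⊕ ε) ε) ⟩
        lookup D ((⊝ i) ⊕ ε) ∧ not (((⊝ i) ⊕ ε) == ε) ∎

  overlapS-y∈D : ∀ ε → lookup D ε ≡ true → overlapS (true , ε) + 2 ≡ 2 * k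
  overlapS-y∈D ε ε∈D = subst (λ b → overlapS (true , ε) + 2 * [ b ] ≡ 2 * k) ε∈D (overlapS-yA ε)

  overlapS-y∉D : ∀ ε → lookup D ε ≡ false → overlapS (true , ε) ≡ 2 * k
  overlapS-y∉D ε ε∉D = trans (sym (+-identityʳ (overlapS (true , ε))))
                             (subst (λ b → overlapS (true , ε) + 2 * [ b ] ≡ 2 * k) ε∉D (overlapS-yA ε))

  -- g h⁻¹ lies in A^#, in yD, or in y(A ∖ D), respectively.
  data Connection (adj : Bool) (c : ℕ) : Set where
    within-coset  : adj ≡ true  → c + 2 ≡ n + lam → Connection adj c
    across-in-D   : adj ≡ true  → c + 2 ≡ 2 * k   → Connection adj c
    across-not-in-D : adj ≡ false → c ≡ 2 * k     → Connection adj c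

  connection-via : ∀ w → w ≢ e → Connection (S w) (overlapS w)
  connection-via (false , δ) w≢e = within-coset (cong not (==-≢ δ≢0)) (overlapS-A δ δ≢0)
    where
    δ≢0 : δ ≢ 0ₙ
    δ≢0 δ≡0 = w≢e (cong (false ,_) δ≡0)
  connection-via (true , ε) _ with lookup D ε in ε∈D
  ... | true  = across-in-D refl (overlapS-y∈D ε ε∈D)
  ... | false = across-not-in-D refl (overlapS-y∉D ε ε∈D)

  connection : ∀ g h → g ≢ h → Connection (cayAdj D g h) (common g h)
  connection g h g≢h = subst₂ Connection (sym (cayAdj≡S g h)) (sym (common≡overlapS g h))
    (connection-via (g · (h ⁻¹)) (λ eq → g≢h (𝔾.x∙y⁻¹≈ε⇒x≈y g h eq)))

∸-intro : ∀ {a b c} → a ≡ b + c → a ∸ b ≡ c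
∸-intro {b = b} {c} a≡b+c = trans (cong (_∸ b) a≡b+c) (m+n∸m≡n b c)

gap-square : ∀ k p lam → p + lam ≡ k + 1 → k * k ≡ k + lam * (k + p) → p * p ≡ 2 * k + p
gap-square k p lam p+lam≡k+1 kk≡ = +-cancelˡ-≡ (k * k + k * p) (p * p) (2 * k + p) (begin
  k * k + k * p + p * p            ≡⟨ solve₁ k p ⟩
  p * (k + p) + k * k              ≡⟨ cong (p * (k + p) +_) kk≡ ⟩
  p * (k + p) + (k + lam * (k + p)) ≡⟨ solve₂ k p lam ⟩
  (p + lam) * (k + p) + k          ≡⟨ cong (λ x → x * (k + p) + k) p+lam≡k+1 ⟩
  (k + 1) * (k + p) + k            ≡⟨ solve₃ k p ⟩
  k * k + k * p + (2 * k + p)      ∎)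
  where
  open ≡-Reasoning
  solve₁ : ∀ k p → k * k + k * p + p * p ≡ p * (k + p) + k * k
  solve₁ = solve-∀
  solve₂ : ∀ k p lam → p * (k + p) + (k + lam * (k + p)) ≡ (p + lam) * (k + p) + k
  solve₂ = solve-∀
  solve₃ : ∀ k p → (k + 1) * (k + p) + k ≡ k * k + k * p + (2 * k + p)
  solve₃ = solve-∀

Parameters : ℕ → ℕ → ℕ → Set
Parameters n k lam = ∃[ m ] (m * m ≡ 8 * n ∸ 7) × (2 * k + m ≡ 2 * n ∸ 1) × (lam + m ≡ n + 1)

gap-parameters : ∀ k p lam → p + lam ≡ k + 1 → p * p ≡ 2 * k + p → Parameters (k + suc p) k lam
gap-parameters k p lam p+lam≡k+1 pp≡2k+p = 2 * p + 1 , square , sum , lam+m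
  where
  open ≡-Reasoning
  square : (2 * p + 1) * (2 * p + 1) ≡ 8 * (k + suc p) ∸ 7
  square = sym (∸-intro (begin
    8 * (k + suc p)                     ≡⟨ solve₁ k p ⟩
    7 + (4 * (2 * k + p) + 4 * p + 1)   ≡⟨ cong (λ x → 7 + (4 * x + 4 * p + 1)) pp≡2k+p ⟨
    7 + (4 * (p * p) + 4 * p + 1)       ≡⟨ cong (7 +_) (solve₂ p) ⟩
    7 + (2 * p + 1) * (2 * p + 1)       ∎))
    where
    solve₁ : ∀ k p → 8 * (k + suc p) ≡ 7 + (4 * (2 * k + p) + 4 * p + 1)
    solve₁ = solve-∀
    solve₂ : ∀ p → 4 * (p * p) + 4 * p + 1 ≡ (2 * p + 1) * (2 * p + 1)
    solve₂ = solve-∀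
  sum : 2 * k + (2 * p + 1) ≡ 2 * (k + suc p) ∸ 1
  sum = sym (∸-intro (solve₁ k p))
    where
    solve₁ : ∀ k p → 2 * (k + suc p) ≡ 1 + (2 * k + (2 * p + 1))
    solve₁ = solve-∀
  lam+m : lam + (2 * p + 1) ≡ k + suc p + 1
  lam+m = begin
    lam + (2 * p + 1)  ≡⟨ solve₁ lam p ⟩
    p + lam + (p + 1)  ≡⟨ cong (_+ (p + 1)) p+lam≡k+1 ⟩
    k + 1 + (p + 1)    ≡⟨ solve₂ k p ⟩
    k + suc p + 1      ∎
    where
    solve₁ : ∀ lam p → lam + (2 * p + 1) ≡ p + lam + (p + 1)
    solve₁ = solve-∀
    solve₂ : ∀ k p → k + 1 + (p + 1) ≡ k + suc p + 1
    solve₂ = solve-∀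

module _ {n k lam : ℕ} (kk+lam≡k+lam*n : k * k + lam ≡ k + lam * n)
                       (n+lam≡2k+2 : n + lam ≡ 2 * k + 2) where
  open ≡-Reasoning

  equations⇒k≢n : 2 ≤ n → k ≢ n
  equations⇒k≢n 2≤n k≡n = <⇒≢ 2≤n (sym n≡1)
    where
    lam≡k+2 : lam ≡ k + 2
    lam≡k+2 = +-cancelˡ-≡ k lam (k + 2) (trans (cong (_+ lam) k≡n) (trans n+lam≡2k+2 (solve₁ k)))
      where
      solve₁ : ∀ k → 2 * k + 2 ≡ k + (k + 2)
      solve₁ = solve-∀
    2*1≡2*k : 2 * 1 ≡ 2 * k
    2*1≡2*k = +-cancelˡ-≡ (k * k + k) (2 * 1) (2 * k) (begin
      k * k + k + 2 * 1      ≡⟨ solve₁ k ⟩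
      k * k + (k + 2)        ≡⟨ cong (k * k +_) lam≡k+2 ⟨
      k * k + lam            ≡⟨ kk+lam≡k+lam*n ⟩
      k + lam * n            ≡⟨ cong₂ (λ x y → k + x * y) lam≡k+2 (sym k≡n) ⟩
      k + (k + 2) * k        ≡⟨ solve₂ k ⟩
      k * k + k + 2 * k      ∎)
      where
      solve₁ : ∀ k → k * k + k + 2 * 1 ≡ k * k + (k + 2)
      solve₁ = solve-∀
      solve₂ : ∀ k → k + (k + 2) * k ≡ k * k + k + 2 * k
      solve₂ = solve-∀
    n≡1 : n ≡ 1
    n≡1 = trans (sym k≡n) (sym (*-cancelˡ-≡ 1 k 2 2*1≡2*k))

  equations⇒parameters : 2 ≤ n → k ≤ n → Parameters n k lam
  equations⇒parameters 2≤n k≤n =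
    subst (λ n → Parameters n k lam) k+1+p≡n (gap-parameters k p lam p+lam≡k+1 pp≡2k+p)
    where
    p : ℕ
    p = n ∸ suc k
    k+1+p≡n : k + suc p ≡ n
    k+1+p≡n = trans (+-suc k p) (m+[n∸m]≡n (≤∧≢⇒< k≤n (equations⇒k≢n 2≤n)))
    p+lam≡k+1 : p + lam ≡ k + 1
    p+lam≡k+1 = +-cancelˡ-≡ (k + 1) (p + lam) (k + 1) (begin
      k + 1 + (p + lam)  ≡⟨ solve₁ k p lam ⟩
      k + suc p + lam    ≡⟨ cong (_+ lam) k+1+p≡n ⟩
      n + lam            ≡⟨ n+lam≡2k+2 ⟩
      2 * k + 2          ≡⟨ solve₂ k ⟩
      k + 1 + (k + 1)    ∎)
      where
      solve₁ : ∀ k p lam → k + 1 + (p + lam) ≡ k + suc p + lam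
      solve₁ = solve-∀
      solve₂ : ∀ k → 2 * k + 2 ≡ k + 1 + (k + 1)
      solve₂ = solve-∀
    pp≡2k+p : p * p ≡ 2 * k + p
    pp≡2k+p = gap-square k p lam p+lam≡k+1 (+-cancelʳ-≡ lam (k * k) (k + lam * (k + p)) (begin
      k * k + lam                ≡⟨ kk+lam≡k+lam*n ⟩
      k + lam * n                ≡⟨ cong (λ x → k + lam * x) k+1+p≡n ⟨
      k + lam * (k + suc p)      ≡⟨ solve₁ k p lam ⟩
      k + lam * (k + p) + lam    ∎))
      where
      solve₁ : ∀ k p lam → k + lam * (k + suc p) ≡ k + lam * (k + p) + lam
      solve₁ = solve-∀

module _ {n : ℕ} (k : ℕ) {m : ℕ} (1≤n : 1 ≤ n) (2k+m≡2n∸1 : 2 * k + m ≡ 2 * n ∸ 1) where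

  2k+m+1≡2n : 2 * k + m + 1 ≡ 2 * n
  2k+m+1≡2n = trans (cong (_+ 1) 2k+m≡2n∸1) (m∸n+n≡m (≤-trans 1≤n (m≤m+n n (n + 0))))

  parameters⇒k<n : k < n
  parameters⇒k<n = *-cancelˡ-< 2 k n (begin-strict
    2 * k            ≤⟨ m≤m+n (2 * k) m ⟩
    2 * k + m        <⟨ m<m+n (2 * k + m) (s≤s z≤n) ⟩
    2 * k + m + 1    ≡⟨ 2k+m+1≡2n ⟩
    2 * n            ∎)
    where open ≤-Reasoning

  parameters⇒equation : ∀ {lam} → lam + m ≡ n + 1 → n + lam ≡ 2 * k + 2
  parameters⇒equation {lam} lam+m≡n+1 = +-cancelˡ-≡ m (n + lam) (2 * k + 2) (begin
    m + (n + lam)      ≡⟨ solve₁ m n lam ⟩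
    n + (lam + m)      ≡⟨ cong (n +_) lam+m≡n+1 ⟩
    n + (n + 1)        ≡⟨ solve₂ n ⟩
    2 * n + 1          ≡⟨ cong (_+ 1) 2k+m+1≡2n ⟨
    2 * k + m + 1 + 1  ≡⟨ solve₃ k m ⟩
    m + (2 * k + 2)    ∎)
    where
    open ≡-Reasoning
    solve₁ : ∀ m n lam → m + (n + lam) ≡ n + (lam + m)
    solve₁ = solve-∀
    solve₂ : ∀ n → n + (n + 1) ≡ 2 * n + 1
    solve₂ = solve-∀
    solve₃ : ∀ k m → 2 * k + m + 1 + 1 ≡ m + (2 * k + 2)
    solve₃ = solve-∀

n+lam≡2k+2⇒0<k : ∀ {n k lam} → 3 ≤ n → n + lam ≡ 2 * k + 2 → 0 < k
n+lam≡2k+2⇒0<k {n} {zero} {lam} 3≤n n+lam≡2 with subst (3 ≤_) n+lam≡2 (≤-trans 3≤n (m≤m+n n lam))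
... | s≤s (s≤s ())
n+lam≡2k+2⇒0<k {k = suc _} _ _ = s≤s z≤n

two-values : ∀ {x y z a b : ℕ} → x ≡ a ⊎ x ≡ b → y ≡ a ⊎ y ≡ b → z ≡ a ⊎ z ≡ b →
             y ≢ z → x ≡ y ⊎ x ≡ z
two-values (inj₁ x≡a) (inj₁ y≡a) _          _   = inj₁ (trans x≡a (sym y≡a))
two-values (inj₂ x≡b) (inj₂ y≡b) _          _   = inj₁ (trans x≡b (sym y≡b))
two-values (inj₁ x≡a) (inj₂ _)   (inj₁ z≡a) _   = inj₂ (trans x≡a (sym z≡a))
two-values (inj₂ x≡b) (inj₁ _)   (inj₂ z≡b) _   = inj₂ (trans x≡b (sym z≡b))
two-values (inj₁ _)   (inj₂ y≡b) (inj₂ z≡b) y≢z = ⊥-elim (y≢z (trans y≡b (sym z≡b)))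
two-values (inj₂ _)   (inj₁ y≡a) (inj₁ z≡a) y≢z = ⊥-elim (y≢z (trans y≡a (sym z≡a)))

+2⇒∸2 : ∀ {c a} → c + 2 ≡ a → c ≡ a ∸ 2
+2⇒∸2 {c} c+2≡a = sym (∸-intro (trans (sym c+2≡a) (+-comm c 2)))

c+2≢c : ∀ c → c + 2 ≢ c
c+2≢c c c+2≡c = 0≢1+n (+-cancelˡ-≡ c 0 2 (trans (+-identityʳ c) (sym c+2≡c)))

true≢false : true ≢ false
true≢false ()

module StrictlyDeza (n : ℕ) .{{_ : NonZero n}} (3≤n : 3 ≤ n) (D : Subset n) (k lam : ℕ)
                    (isDS : Dihedral.IsDifferenceSet n D n k lam) where
  open Dihedral n
  open Cyclic n
  open Dihedral.CayGraph n D
  open CayleyGraph n D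
  open DifferenceSet n D k lam isDS
  open DifferenceSetCayleyGraph n D k lam isDS

  2≤n : 2 ≤ n
  2≤n = ≤-trans (n≤1+n 2) 3≤n

  one : Fin n
  one = 1 mod n

  one≢0ₙ : one ≢ 0ₙ
  one≢0ₙ one≡0 = 0≢1+n (begin
    0         ≡⟨ toℕ-0ₙ ⟨
    toℕ 0ₙ    ≡⟨ cong toℕ one≡0 ⟨
    toℕ one   ≡⟨ toℕ-mod 1 ⟩
    1 % n     ≡⟨ m<n⇒m%n≡m 2≤n ⟩
    1         ∎)
    where open ≡-Reasoning

  x : G
  x = (false , one)

  x≢e : x ≢ e
  x≢e x≡e = one≢0ₙ (cong proj₂ x≡e)

  x~e : cayAdj D x e ≡ true
  x~e = trans (cayAdj-e≡S x) (cong not (==-≢ one≢0ₙ))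

  common-x-e : common x e + 2 ≡ n + lam
  common-x-e = trans (cong (_+ 2) (common-e≡overlapS x)) (overlapS-A one one≢0ₙ)

  D-nonempty : ∃[ d ] lookup D d ≡ true
  D-nonempty =
    let d , d,d+1∈D = 0<countFin⇒∃ (λ u → lookup D u ∧ lookup D (u ⊕ one))
                                   (subst (0 <_) (sym (Λ-≢0ₙ one one≢0ₙ)) 0<lam)
    in d , ∧-conicalˡ (lookup D d) _ d,d+1∈D

  d : Fin n
  d = proj₁ D-nonempty

  d∈D : lookup D d ≡ true
  d∈D = proj₂ D-nonempty

  yxᵈ : G
  yxᵈ = (true , d)

  yxᵈ≢e : yxᵈ ≢ e
  yxᵈ≢e ()

  yxᵈ~e : cayAdj D yxᵈ e ≡ true
  yxᵈ~e = trans (cayAdj-e≡S yxᵈ) d∈D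

  common-yxᵈ-e : common yxᵈ e + 2 ≡ 2 * k
  common-yxᵈ-e = trans (cong (_+ 2) (common-e≡overlapS yxᵈ)) (overlapS-y∈D d d∈D)

  regular : IsRegular (n + k ∸ 1)
  regular g = sym (∸-intro (begin
    n + k             ≡⟨ countG-S ⟨
    countG S + 1      ≡⟨ cong (_+ 1) (degree≡countG-S g) ⟨
    degree g + 1      ≡⟨ +-comm (degree g) 1 ⟩
    1 + degree g      ∎))
    where open ≡-Reasoning

  n+lam≡2k⇒srg : n + lam ≡ 2 * k → IsStronglyRegular
  n+lam≡2k⇒srg n+lam≡2k = n + k ∸ 1 , regular , 2 * k ∸ 2 , 2 * k , classes
    where
    classes : ∀ g h → g ≢ h → (cayAdj D g h ≡ true → common g h ≡ 2 * k ∸ 2)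
                             × (cayAdj D g h ≡ false → common g h ≡ 2 * k)
    classes g h g≢h with connection g h g≢h
    ... | within-coset adj c    = (λ _ → +2⇒∸2 (trans c n+lam≡2k))
                                , (λ g≁h → ⊥-elim (true≢false (trans (sym adj) g≁h)))
    ... | across-in-D adj c     = (λ _ → +2⇒∸2 c)
                                , (λ g≁h → ⊥-elim (true≢false (trans (sym adj) g≁h)))
    ... | across-not-in-D g≁h c = (λ adj → ⊥-elim (true≢false (trans (sym adj) g≁h)))
                                , (λ _ → c)

  strictlyDeza⇒equation : IsStrictlyDeza → n + lam ≡ 2 * k + 2
  strictlyDeza⇒equation ((_ , _ , _ , _ , values) , ¬srg , (_ , (g , h , g≢h , g≁h))) =
    conclude (two-values (values x e x≢e) (values yxᵈ e yxᵈ≢e) (values g h g≢h) common-yxᵈ≢common-g)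
    where
    common-g-h : common g h ≡ 2 * k
    common-g-h with connection g h g≢h
    ... | within-coset adj _    = ⊥-elim (true≢false (trans (sym adj) g≁h))
    ... | across-in-D adj _     = ⊥-elim (true≢false (trans (sym adj) g≁h))
    ... | across-not-in-D _ c   = c
    common-yxᵈ≢common-g : common yxᵈ e ≢ common g h
    common-yxᵈ≢common-g eq = c+2≢c (common yxᵈ e) (trans common-yxᵈ-e (trans (sym common-g-h) (sym eq)))
    conclude : common x e ≡ common yxᵈ e ⊎ common x e ≡ common g h → n + lam ≡ 2 * k + 2
    conclude (inj₁ common-x≡common-yxᵈ) = ⊥-elim (¬srg (n+lam≡2k⇒srg
      (trans (sym common-x-e) (trans (cong (_+ 2) common-x≡common-yxᵈ) common-yxᵈ-e))))
    conclude (inj₂ common-x≡common-g) =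
      trans (sym common-x-e) (cong (_+ 2) (trans common-x≡common-g common-g-h))

  module _ (n+lam≡2k+2 : n + lam ≡ 2 * k + 2) where

    common-x-e≡2k : common x e ≡ 2 * k
    common-x-e≡2k = +-cancelʳ-≡ 2 (common x e) (2 * k) (trans common-x-e n+lam≡2k+2)

    isDeza : IsDeza
    isDeza = n + k ∸ 1 , regular , 2 * k , 2 * k ∸ 2 , values
      where
      values : ∀ g h → g ≢ h → common g h ≡ 2 * k ⊎ common g h ≡ 2 * k ∸ 2
      values g h g≢h with connection g h g≢h
      ... | within-coset _ c    = inj₁ (+-cancelʳ-≡ 2 _ _ (trans c n+lam≡2k+2))
      ... | across-in-D _ c     = inj₂ (+2⇒∸2 c)
      ... | across-not-in-D _ c = inj₁ c

    ¬srg : ¬ IsStronglyRegular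
    ¬srg (_ , _ , lam′ , _ , classes) = c+2≢c (common yxᵈ e) (begin
      common yxᵈ e + 2 ≡⟨ common-yxᵈ-e ⟩
      2 * k            ≡⟨ common-x-e≡2k ⟨
      common x e       ≡⟨ proj₁ (classes x e x≢e) x~e ⟩
      lam′             ≡⟨ proj₁ (classes yxᵈ e yxᵈ≢e) yxᵈ~e ⟨
      common yxᵈ e     ∎)
      where open ≡-Reasoning

    diameter-2 : k < n → HasDiameter2
    diameter-2 k<n = within-2 , ((true , j) , e , (λ ()) , trans (cayAdj-e≡S (true , j)) j∉D)
      where
      j : Fin n
      j = proj₁ (countFin<⇒∃ (lookup D) (subst (_< n) (sym |D|≡k) k<n))
      j∉D : lookup D j ≡ false
      j∉D = proj₂ (countFin<⇒∃ (lookup D) (subst (_< n) (sym |D|≡k) k<n))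
      0<2k : 0 < 2 * k
      0<2k = ≤-trans (n+lam≡2k+2⇒0<k 3≤n n+lam≡2k+2) (m≤m+n k (k + 0))
      within-2 : ∀ g h → g ≢ h → cayAdj D g h ≡ true ⊎ common g h ≢ 0
      within-2 g h g≢h with connection g h g≢h
      ... | within-coset adj _  = inj₁ adj
      ... | across-in-D adj _   = inj₁ adj
      ... | across-not-in-D _ c = inj₂ (λ c≡0 → <⇒≢ 0<2k (trans (sym c≡0) c))

lemma3p1 : (n : ℕ) .{{_ : NonZero n}} → 3 ≤ n →
    (D : Subset n) (k lam : ℕ) → Dihedral.IsDifferenceSet n D n k lam →
    (Dihedral.CayGraph.IsStrictlyDeza n D
      ⇔ (∃[ m ] (m * m ≡ 8 * n ∸ 7) × (2 * k + m ≡ 2 * n ∸ 1) × (lam + m ≡ n + 1)))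
lemma3p1 n 3≤n D k lam isDS = mk⇔ to from
  where
  open StrictlyDeza n 3≤n D k lam isDS
  open DifferenceSet n D k lam isDS using (|D|≡k; difference-set-equation)

  k≤n : k ≤ n
  k≤n = subst (_≤ n) |D|≡k (countFin-≤ (lookup D))

  to : Dihedral.CayGraph.IsStrictlyDeza n D → Parameters n k lam
  to strictlyDeza = equations⇒parameters difference-set-equation (strictlyDeza⇒equation strictlyDeza) 2≤n k≤n

  from : Parameters n k lam → Dihedral.CayGraph.IsStrictlyDeza n D
  from (_ , _ , 2k+m≡2n∸1 , lam+m≡n+1) = isDeza n+lam≡2k+2 , ¬srg n+lam≡2k+2 ,
                                          diameter-2 n+lam≡2k+2 (parameters⇒k<n k 1≤n 2k+m≡2n∸1)
    where
    1≤n : 1 ≤ n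
    1≤n = ≤-trans (s≤s z≤n) 3≤n
    n+lam≡2k+2 : n + lam ≡ 2 * k + 2
    n+lam≡2k+2 = parameters⇒equation k 1≤n 2k+m≡2n∸1 lam+m≡n+1
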